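{- Let $p$ be a prime, let $\ell,u\ge1$ be integers and let $m$ be an integer with $0\le m\le p^\ell$. Then for arbitrarily large integers $r\ge0$ there exists a polynomial $P\in\mathbb Z[t]$ such that the set of residues $t\bmod p^{r+\ell}$ with $P(t)\equiv0\pmod{p^{r+\ell}}$ has exactly $mp^r$ elements, and $v_p(P(t))\le r+\ell-u$ for every integer $t$ whose residue modulo $p^{r+\ell}$ is not one of these zeros.
   Context: $v_p$ denotes the $p$-adic valuation. -}

module Defs where

open import Data.Nat as ℕ using (ℕ; zero; suc)
open import Data.Nat.Divisibility as ℕD using ()
open import Data.Integer as ℤ using (ℤ; +_)
open import Data.Integer.Divisibility using (_∣_)
open import Data.List using (List; []; _∷_; length; filter; upTo)
open import Data.Product using (_×_)
open import Relation.Nullary using (¬_)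

-- A polynomial in ℤ[t], given by its list of coefficients,
-- lowest degree first: a₀ ∷ a₁ ∷ … represents a₀ + a₁ t + ….
Poly : Set
Poly = List ℤ

eval : Poly → ℤ → ℤ
eval []       t = + 0
eval (a ∷ as) t = a ℤ.+ t ℤ.* eval as t

-- Number of residues t mod N (represented by t = 0, …, N-1)
-- with P(t) ≡ 0 (mod N).  (ℤ-divisibility is ℕ-divisibility of ∣_∣.)
numZerosMod : Poly → ℕ → ℕ
numZerosMod P N = length (filter (λ t → N ℕD.∣? ℤ.∣ eval P (+ t) ∣) (upTo N))

-- v_p(x) = k, i.e. p^k ∣ x and p^(k+1) ∤ x  (only possible for x ≠ 0).
HasValuation : ℕ → ℤ → ℕ → Set
HasValuation p x k = (+ (p ℕ.^ k) ∣ x) × ¬ (+ (p ℕ.^ suc k) ∣ x)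

{-# OPTIONS --safe #-}
module Submission where

-- By induction on ℓ we build P with a depth b such that every t either has p^(b+u) ∣ P(t)
-- (a root) or v_p(P(t)) ≤ b, the roots fill exactly m of the classes modulo p^ℓ, and on one
-- further class s modulo p^ℓ (the spine) v_p(P(t)) = b exactly.  Writing m = p m′ + q with
-- q < p, the next stage is P′ = P^M · ∏_{d<q} (t − s − d p^ℓ)^u with M = quℓ + u: the old roots
-- stay roots because M(b+u) ≥ b′+u, the new factors create q root classes modulo p^(ℓ+1)
-- inside the spine, and every other t has valuation at most b′ = Mb + quℓ, with equality on
-- the new spine s + q p^ℓ.  Multiplying the final polynomial by a power of p then moves the
-- threshold b+u to r+ℓ for any large r; the case m = p^ℓ is the zero polynomial.

open import Data.Nat.Base as ℕ using (ℕ)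
open import Data.Nat.Primality using (Prime)

module Counting where

  open import Data.List using ([]; length; filter; upTo; _++_; [_])
  import Data.List.Properties as List
  open import Data.Nat
  open import Data.Nat.Properties
  open import Data.Product using (_×_; _,_)
  open import Algebra.Properties.CommutativeSemigroup +-commutativeSemigroup using (interchange)
  open import Function using (_∘′_)
  open import Relation.Nullary using (¬_; Dec; yes; no; contradiction)
  open import Relation.Nullary.Decidable using (_⊎-dec_)
  open import Relation.Unary using (Decidable)
  open import Relation.Binary.PropositionalEquality hiding ([_])
  open ≡-Reasoning

  private variable
    A B : Set
    P Q : ℕ → Set

  indicator : Dec A → ℕ
  indicator (yes _) = 1
  indicator (no  _) = 0

  indicator-⊎ : (¬ (A × B)) → (a? : Dec A) (b? : Dec B) → indicator (a? ⊎-dec b?) ≡ indicator a? + indicator b?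
  indicator-⊎ disjoint (yes a) (yes b) = contradiction (a , b) disjoint
  indicator-⊎ disjoint (yes _) (no  _) = refl
  indicator-⊎ disjoint (no  _) (yes _) = refl
  indicator-⊎ disjoint (no  _) (no  _) = refl

  indicator-cong : (A → B) → (B → A) → (a? : Dec A) (b? : Dec B) → indicator a? ≡ indicator b?
  indicator-cong A⇒B B⇒A (yes _) (yes _) = refl
  indicator-cong A⇒B B⇒A (yes a) (no ¬b) = contradiction (A⇒B a) ¬b
  indicator-cong A⇒B B⇒A (no ¬a) (yes b) = contradiction (B⇒A b) ¬a
  indicator-cong A⇒B B⇒A (no _)  (no _)  = refl

  indicator-yes : A → (a? : Dec A) → indicator a? ≡ 1
  indicator-yes a (yes _) = refl
  indicator-yes a (no ¬a) = contradiction a ¬a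

  count : Decidable P → ℕ → ℕ
  count P? zero    = 0
  count P? (suc n) = count P? n + indicator (P? n)

  length-filter-upTo : (P? : Decidable P) (n : ℕ) → length (filter P? (upTo n)) ≡ count P? n
  length-filter-upTo P? zero    = refl
  length-filter-upTo {P = P} P? (suc n) = begin
    length (filter P? (upTo (suc n)))                       ≡⟨ cong (length ∘′ filter P?) (sym (List.upTo-∷ʳ n)) ⟩
    length (filter P? (upTo n ++ [ n ]))                    ≡⟨ cong length (List.filter-++ P? (upTo n) [ n ]) ⟩
    length (filter P? (upTo n) ++ filter P? [ n ])          ≡⟨ List.length-++ (filter P? (upTo n)) ⟩
    length (filter P? (upTo n)) + length (filter P? [ n ])  ≡⟨ cong₂ _+_ (length-filter-upTo P? n) (last (P? n)) ⟩
    count P? (suc n)                                        ∎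
    where
    last : (d : Dec (P n)) → length (filter P? [ n ]) ≡ indicator d
    last (yes p) = cong length (List.filter-accept P? {x = n} {xs = []} p)
    last (no ¬p) = cong length (List.filter-reject P? {x = n} {xs = []} ¬p)

  count-cong : (P? : Decidable P) (Q? : Decidable Q) →
               (∀ n → P n → Q n) → (∀ n → Q n → P n) → ∀ N → count P? N ≡ count Q? N
  count-cong P? Q? P⇒Q Q⇒P zero    = refl
  count-cong P? Q? P⇒Q Q⇒P (suc N) =
    cong₂ _+_ (count-cong P? Q? P⇒Q Q⇒P N) (indicator-cong (P⇒Q N) (Q⇒P N) (P? N) (Q? N))

  count-+ : (P? : Decidable P) (a b : ℕ) → count P? (a + b) ≡ count P? a + count (λ n → P? (a + n)) b
  count-+ P? a zero    = trans (cong (count P?) (+-identityʳ a)) (sym (+-identityʳ _))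
  count-+ P? a (suc b) = begin
    count P? (a + suc b)                                                  ≡⟨ cong (count P?) (+-suc a b) ⟩
    count P? (a + b) + indicator (P? (a + b))                             ≡⟨ cong (_+ indicator (P? (a + b))) (count-+ P? a b) ⟩
    count P? a + count (λ n → P? (a + n)) b + indicator (P? (a + b))      ≡⟨ +-assoc (count P? a) _ _ ⟩
    count P? a + count (λ n → P? (a + n)) (suc b)                         ∎

  count-none : (P? : Decidable P) (N : ℕ) → (∀ n → n < N → ¬ P n) → count P? N ≡ 0
  count-none P? zero    none = refl
  count-none P? (suc N) none with P? N
  ... | yes p = contradiction p (none N (n<1+n N))
  ... | no  _ = trans (+-identityʳ _) (count-none P? N (λ n n<N → none n (m<n⇒m<1+n n<N)))

  count-all : (P? : Decidable P) → (∀ n → P n) → ∀ N → count P? N ≡ N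
  count-all P? all zero    = refl
  count-all P? all (suc N) with P? N
  ... | yes _ = trans (cong (_+ 1) (count-all P? all N)) (+-comm N 1)
  ... | no ¬p = contradiction (all N) ¬p

  count-⊎ : (P? : Decidable P) (Q? : Decidable Q) → (∀ n → P n → ¬ Q n) →
            ∀ N → count (λ n → P? n ⊎-dec Q? n) N ≡ count P? N + count Q? N
  count-⊎ P? Q? disjoint zero    = refl
  count-⊎ P? Q? disjoint (suc N) = begin
    count (λ n → P? n ⊎-dec Q? n) N + indicator (P? N ⊎-dec Q? N)
      ≡⟨ cong₂ _+_ (count-⊎ P? Q? disjoint N) (indicator-⊎ (λ (p , q) → disjoint N p q) (P? N) (Q? N)) ⟩
    (count P? N + count Q? N) + (indicator (P? N) + indicator (Q? N))
      ≡⟨ interchange (count P? N) _ _ _ ⟩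
    count P? (suc N) + count Q? (suc N) ∎

  count-periodic : (P? : Decidable P) (a : ℕ) → (∀ n → P (a + n) → P n) → (∀ n → P n → P (a + n)) →
                   ∀ K → count P? (a * K) ≡ count P? a * K
  count-periodic P? a shift⁻ shift zero    = trans (cong (count P?) (*-zeroʳ a)) (sym (*-zeroʳ (count P? a)))
  count-periodic P? a shift⁻ shift (suc K) = begin
    count P? (a * suc K)                          ≡⟨ cong (count P?) (*-suc a K) ⟩
    count P? (a + a * K)                          ≡⟨ count-+ P? a (a * K) ⟩
    count P? a + count (λ n → P? (a + n)) (a * K) ≡⟨ cong (count P? a +_) (count-cong _ P? shift⁻ shift (a * K)) ⟩
    count P? a + count P? (a * K)                 ≡⟨ cong (count P? a +_) (count-periodic P? a shift⁻ shift K) ⟩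
    count P? a + count P? a * K                   ≡⟨ *-suc (count P? a) K ⟨
    count P? a * suc K                            ∎

  count-unique : (P? : Decidable P) {c a : ℕ} → c < a → P c → (∀ n → n < a → P n → n ≡ c) → count P? a ≡ 1
  count-unique P? {c} {a} c<a Pc unique = begin
    count P? a                                                                 ≡⟨ cong (count P?) (m+[n∸m]≡n c<a) ⟨
    count P? (suc c + (a ∸ suc c))                                             ≡⟨ count-+ P? (suc c) (a ∸ suc c) ⟩
    count P? c + indicator (P? c) + count (λ n → P? (suc c + n)) (a ∸ suc c)   ≡⟨ cong₂ (λ x y → x + indicator (P? c) + y) below above ⟩
    indicator (P? c) + 0                                                       ≡⟨ +-identityʳ _ ⟩
    indicator (P? c)                                                           ≡⟨ indicator-yes Pc (P? c) ⟩
    1                                                                          ∎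
    where
    below : count P? c ≡ 0
    below = count-none P? c (λ n n<c Pn → <⇒≢ n<c (unique n (<-trans n<c c<a) Pn))
    above : count (λ n → P? (suc c + n)) (a ∸ suc c) ≡ 0
    above = count-none _ (a ∸ suc c) λ n n<rest Pn →
      <⇒≢ (m≤m+n (suc c) n) (sym (unique (suc c + n) (subst (suc c + n <_) (m+[n∸m]≡n c<a) (+-monoʳ-< (suc c) n<rest)) Pn))



module Residues where

  open import Data.Integer using (+_; -_; _+_; _-_; ∣_∣)
  open import Data.Integer.Divisibility.Signed using (_∣_; _∣?_; divides; ∣⇒∣ᵤ; ∣-refl; ∣m∣n⇒∣m+n; ∣m+n∣n⇒∣m)
  open import Data.Integer.Properties using (+-assoc; +-comm; +-injective; i-j≡0⇒i≡j; ∣i∣≡0⇒i≡0; m-n≡m⊖n; ∣m⊝n∣≤m⊔n; pos-+; +-inverseʳ)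
  open import Data.Nat as ℕ using (zero; suc; _<_; _⊔_)
  open import Data.Nat.Divisibility as ℕ using (>⇒∤)
  open import Data.Nat.Properties using (≤-<-trans; ⊔-lub; *-identityˡ)
  open import Relation.Nullary using (contradiction)
  open import Relation.Binary.PropositionalEquality
  open ≡-Reasoning
  open Counting

  ∣∧<⇒≡0 : ∀ {m n} → m ℕ.∣ n → n < m → n ≡ 0
  ∣∧<⇒≡0 {n = zero}  _   _   = refl
  ∣∧<⇒≡0 {n = suc n} m∣n n<m = contradiction m∣n (>⇒∤ n<m)

  residue-unique : ∀ {a n C} → n < a → C < a → + a ∣ + n - + C → n ≡ C
  residue-unique {a} {n} {C} n<a C<a a∣n-C =
    +-injective (i-j≡0⇒i≡j (+ n) (+ C) (∣i∣≡0⇒i≡0 (∣∧<⇒≡0 (∣⇒∣ᵤ a∣n-C) ∣n-C∣<a)))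
    where
    ∣n-C∣<a : ∣ + n - + C ∣ < a
    ∣n-C∣<a = ≤-<-trans (subst (ℕ._≤ n ⊔ C) (cong ∣_∣ (sym (m-n≡m⊖n n C))) (∣m⊝n∣≤m⊔n n C)) (⊔-lub n<a C<a)

  count-residue : ∀ {a C} → C < a → ∀ K → count (λ n → + a ∣? + n - + C) (a ℕ.* K) ≡ K
  count-residue {a} {C} C<a K = begin
    count R? (a ℕ.* K)  ≡⟨ count-periodic R? a shift⁻ shift K ⟩
    count R? a ℕ.* K    ≡⟨ cong (ℕ._* K) one-per-period ⟩
    1 ℕ.* K             ≡⟨ *-identityˡ K ⟩
    K                   ∎
    where
    R? = λ n → + a ∣? + n - + C
    shifted : ∀ n → + (a ℕ.+ n) - + C ≡ (+ n - + C) + + a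
    shifted n = trans (cong (_- + C) (pos-+ a n)) (trans (+-assoc (+ a) (+ n) (- + C)) (+-comm (+ a) (+ n - + C)))
    shift⁻ : ∀ n → + a ∣ + (a ℕ.+ n) - + C → + a ∣ + n - + C
    shift⁻ n d = ∣m+n∣n⇒∣m (subst (+ a ∣_) (shifted n) d) ∣-refl
    shift : ∀ n → + a ∣ + n - + C → + a ∣ + (a ℕ.+ n) - + C
    shift n d = subst (+ a ∣_) (sym (shifted n)) (∣m∣n⇒∣m+n d ∣-refl)
    one-per-period : count R? a ≡ 1
    one-per-period = count-unique R? C<a (subst (+ a ∣_) (sym (+-inverseʳ (+ C))) (divides (+ 0) refl))
                       (λ n n<a d → residue-unique n<a C<a d)

module PolynomialArithmetic where

  open import Defs using (Poly; eval)
  open import Data.Integer using (ℤ; +_; _+_; _*_; -_; _-_; _^_)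
  open import Data.Integer.Properties using (+-identityˡ; +-identityʳ; +-comm; *-zeroʳ; *-identityʳ)
  open import Data.Integer.Tactic.RingSolver using (solve-∀)
  open import Data.List using ([]; _∷_)
  open import Data.Nat using (ℕ; zero; suc)
  open import Relation.Binary.PropositionalEquality

  infixl 6 _+ₚ_
  infixl 7 _*ₚ_ _·ₚ_
  infixr 8 _^ₚ_

  _+ₚ_ : Poly → Poly → Poly
  []       +ₚ Q        = Q
  (a ∷ P)  +ₚ []       = a ∷ P
  (a ∷ P)  +ₚ (b ∷ Q)  = a + b ∷ P +ₚ Q

  _·ₚ_ : ℤ → Poly → Poly
  a ·ₚ []      = []
  a ·ₚ (b ∷ Q) = a * b ∷ a ·ₚ Q

  _*ₚ_ : Poly → Poly → Poly
  []      *ₚ Q = []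
  (a ∷ P) *ₚ Q = a ·ₚ Q +ₚ (+ 0 ∷ P *ₚ Q)

  1ₚ : Poly
  1ₚ = + 1 ∷ []

  _^ₚ_ : Poly → ℕ → Poly
  P ^ₚ zero  = 1ₚ
  P ^ₚ suc k = P *ₚ P ^ₚ k

  X-_ : ℤ → Poly
  X- c = - c ∷ 1ₚ

  eval-+ₚ : ∀ P Q t → eval (P +ₚ Q) t ≡ eval P t + eval Q t
  eval-+ₚ []      Q       t = sym (+-identityˡ _)
  eval-+ₚ (a ∷ P) []      t = sym (+-identityʳ _)
  eval-+ₚ (a ∷ P) (b ∷ Q) t rewrite eval-+ₚ P Q t = identity a b t (eval P t) (eval Q t)
    where identity : ∀ a b t x y → a + b + t * (x + y) ≡ a + t * x + (b + t * y)
          identity = solve-∀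

  eval-·ₚ : ∀ a Q t → eval (a ·ₚ Q) t ≡ a * eval Q t
  eval-·ₚ a []      t = sym (*-zeroʳ a)
  eval-·ₚ a (b ∷ Q) t rewrite eval-·ₚ a Q t = identity a b t (eval Q t)
    where identity : ∀ a b t x → a * b + t * (a * x) ≡ a * (b + t * x)
          identity = solve-∀

  eval-*ₚ : ∀ P Q t → eval (P *ₚ Q) t ≡ eval P t * eval Q t
  eval-*ₚ []      Q t = refl
  eval-*ₚ (a ∷ P) Q t rewrite eval-+ₚ (a ·ₚ Q) (+ 0 ∷ P *ₚ Q) t | eval-·ₚ a Q t | eval-*ₚ P Q t =
    identity a t (eval P t) (eval Q t)
    where identity : ∀ a t x y → a * y + (+ 0 + t * (x * y)) ≡ (a + t * x) * y
          identity = solve-∀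

  eval-1ₚ : ∀ t → eval 1ₚ t ≡ + 1
  eval-1ₚ t = trans (cong (_+_ (+ 1)) (*-zeroʳ t)) (+-identityʳ (+ 1))

  eval-^ₚ : ∀ P k t → eval (P ^ₚ k) t ≡ eval P t ^ k
  eval-^ₚ P zero    t = eval-1ₚ t
  eval-^ₚ P (suc k) t rewrite eval-*ₚ P (P ^ₚ k) t | eval-^ₚ P k t = refl

  eval-X- : ∀ c t → eval (X- c) t ≡ t - c
  eval-X- c t = begin
    - c + t * eval 1ₚ t  ≡⟨ cong (λ x → - c + t * x) (eval-1ₚ t) ⟩
    - c + t * + 1        ≡⟨ cong (_+_ (- c)) (*-identityʳ t) ⟩
    - c + t              ≡⟨ +-comm (- c) t ⟩
    t - c                ∎
    where open ≡-Reasoning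

module Valuation (p : ℕ) (p-prime : Prime p) where

  open import Data.Integer as ℤ using (ℤ; +_; _+_; _*_; _-_; _^_; ∣_∣)
  open import Data.Integer.Divisibility.Signed as ℤ∣ using (divides)
  open import Data.Integer.Properties using (pos-*; *-comm; *-assoc; *-identityʳ; *-cancelˡ-≡; abs-*)
  open import Data.Integer.Tactic.RingSolver using (solve-∀)
  open import Data.Nat as ℕ using (ℕ; zero; suc; _≤_; _<_)
  import Data.Nat.Divisibility as ℕ
  open import Data.Nat.Primality using (euclidsLemma; prime⇒nonZero; prime⇒nonTrivial)
  open import Data.Nat.Properties using (≤-refl; <⇒≢; <⇒≱; ≮⇒≥; n≤1+n; m≤n⇒m≤1+n; m+[n∸m]≡n; ^-distribˡ-+-*; m^n≢0)
  open import Data.Product using (Σ; _×_; _,_)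
  open import Data.Sum using (inj₁; inj₂)
  open import Relation.Nullary using (¬_; Dec; yes; no; contradiction)
  open import Relation.Nullary.Decidable using (map′)
  open import Relation.Binary.PropositionalEquality
  open ≡-Reasoning

  instance
    p-nonZero : ℕ.NonZero p
    p-nonZero = prime⇒nonZero p-prime

  p^ᶻ_ : ℕ → ℤ
  p^ᶻ a = + (p ℕ.^ a)

  p^ᶻ-nonZero : ∀ a → ℤ.NonZero (p^ᶻ a)
  p^ᶻ-nonZero a = m^n≢0 p a

  p^ᶻ-+ : ∀ a b → p^ᶻ (a ℕ.+ b) ≡ p^ᶻ a * p^ᶻ b
  p^ᶻ-+ a b = trans (cong +_ (^-distribˡ-+-* p a b)) (pos-* (p ℕ.^ a) (p ℕ.^ b))

  p^ᶻ-suc : ∀ a → p^ᶻ suc a ≡ + p * p^ᶻ a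
  p^ᶻ-suc a = pos-* p (p ℕ.^ a)

  -- Wrapped in records so that the exponent can be inferred from the type.
  infix 4 p^_∣_ p^_∥_ p^_∣?_

  record p^_∣_ (a : ℕ) (x : ℤ) : Set where
    constructor p^∣
    field proof : p^ᶻ a ℤ∣.∣ x

  record p^_∥_ (c : ℕ) (x : ℤ) : Set where
    constructor p^∥
    field
      unit       : ℤ
      factorised : x ≡ p^ᶻ c * unit
      p∤unit     : ¬ (+ p ℤ∣.∣ unit)

  p∤1 : ¬ (+ p ℤ∣.∣ + 1)
  p∤1 p∣1 = <⇒≢ (ℕ.nonTrivial⇒n>1 p {{prime⇒nonTrivial p-prime}}) (sym (ℕ.∣1⇒≡1 (ℤ∣.∣⇒∣ᵤ p∣1)))

  p∤-* : ∀ {v w} → ¬ (+ p ℤ∣.∣ v) → ¬ (+ p ℤ∣.∣ w) → ¬ (+ p ℤ∣.∣ v * w)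
  p∤-* {v} {w} p∤v p∤w p∣vw
    with euclidsLemma ∣ v ∣ ∣ w ∣ p-prime (subst (p ℕ.∣_) (abs-* v w) (ℤ∣.∣⇒∣ᵤ p∣vw))
  ... | inj₁ p∣v = p∤v (ℤ∣.∣ᵤ⇒∣ p∣v)
  ... | inj₂ p∣w = p∤w (ℤ∣.∣ᵤ⇒∣ p∣w)

  p^_∣?_ : ∀ a x → Dec (p^ a ∣ x)
  p^ a ∣? x = map′ p^∣ p^_∣_.proof (p^ᶻ a ℤ∣.∣? x)

  p^0∣ : ∀ x → p^ 0 ∣ x
  p^0∣ x = p^∣ (divides x (sym (*-identityʳ x)))

  ∣-multiple : ∀ a k → p^ a ∣ k * p^ᶻ a
  ∣-multiple a k = p^∣ (divides k refl)

  ∣-+ : ∀ {a x y} → p^ a ∣ x → p^ a ∣ y → p^ a ∣ x + y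
  ∣-+ (p^∣ d) (p^∣ e) = p^∣ (ℤ∣.∣m∣n⇒∣m+n d e)

  ∣-difference : ∀ {a x y} → p^ a ∣ x → p^ a ∣ y → p^ a ∣ x - y
  ∣-difference (p^∣ d) (p^∣ e) = p^∣ (ℤ∣.∣m∣n⇒∣m-n d e)

  ∣-* : ∀ {a b x y} → p^ a ∣ x → p^ b ∣ y → p^ (a ℕ.+ b) ∣ x * y
  ∣-* {a} {b} (p^∣ (divides q refl)) (p^∣ (divides r refl)) = p^∣ (divides (q * r) (begin
    q * p^ᶻ a * (r * p^ᶻ b)    ≡⟨ interchange q (p^ᶻ a) r (p^ᶻ b) ⟩
    q * r * (p^ᶻ a * p^ᶻ b)    ≡⟨ cong (q * r *_) (p^ᶻ-+ a b) ⟨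
    q * r * p^ᶻ (a ℕ.+ b)      ∎))
    where interchange : ∀ q A r B → q * A * (r * B) ≡ q * r * (A * B)
          interchange = solve-∀

  ∣-^ : ∀ {a x} → p^ a ∣ x → ∀ k → p^ (k ℕ.* a) ∣ x ^ k
  ∣-^ d zero    = p^0∣ _
  ∣-^ d (suc k) = ∣-* d (∣-^ d k)

  ∣-weaken : ∀ {a b x} → b ≤ a → p^ a ∣ x → p^ b ∣ x
  ∣-weaken {a} {b} b≤a (p^∣ (divides q refl)) = p^∣ (divides (q * p^ᶻ (a ℕ.∸ b)) (begin
    q * p^ᶻ a                         ≡⟨ cong (λ e → q * p^ᶻ e) (m+[n∸m]≡n b≤a) ⟨
    q * p^ᶻ (b ℕ.+ (a ℕ.∸ b))         ≡⟨ cong (q *_) (p^ᶻ-+ b (a ℕ.∸ b)) ⟩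
    q * (p^ᶻ b * p^ᶻ (a ℕ.∸ b))       ≡⟨ rearrange q (p^ᶻ b) (p^ᶻ (a ℕ.∸ b)) ⟩
    q * p^ᶻ (a ℕ.∸ b) * p^ᶻ b         ∎))
    where rearrange : ∀ q B C → q * (B * C) ≡ q * C * B
          rearrange = solve-∀

  ∣-cancelʳ : ∀ {a x y} → p^ a ∣ x + y → p^ a ∣ y → p^ a ∣ x
  ∣-cancelʳ (p^∣ d) (p^∣ e) = p^∣ (ℤ∣.∣m+n∣n⇒∣m d e)

  p^-cancelˡ-∣ : ∀ a {b y} → p^ (a ℕ.+ b) ∣ p^ᶻ a * y → p^ b ∣ y
  p^-cancelˡ-∣ a {b} (p^∣ d) = p^∣ (ℤ∣.*-cancelˡ-∣ (p^ᶻ a) {{p^ᶻ-nonZero a}} (subst (ℤ∣._∣ _) (p^ᶻ-+ a b) d))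

  ∥⇒∣ : ∀ {c x} → p^ c ∥ x → p^ c ∣ x
  ∥⇒∣ {c} (p^∥ w refl _) = p^∣ (divides w (*-comm (p^ᶻ c) w))

  ∥⇒∤ : ∀ {c n x} → p^ c ∥ x → c < n → ¬ p^ n ∣ x
  ∥⇒∤ {c} {n} {x} v c<n d = ∤-suc v (∣-weaken c<n d)
    where
    ∤-suc : ∀ {c x} → p^ c ∥ x → ¬ p^ suc c ∣ x
    ∤-suc {c} (p^∥ w refl p∤w) (p^∣ (divides q eq)) =
      p∤w (divides q (*-cancelˡ-≡ (p^ᶻ c) w (q * + p) {{p^ᶻ-nonZero c}} (begin
        p^ᶻ c * w           ≡⟨ eq ⟩
        q * p^ᶻ suc c       ≡⟨ cong (q *_) (p^ᶻ-suc c) ⟩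
        q * (+ p * p^ᶻ c)   ≡⟨ rearrange q (+ p) (p^ᶻ c) ⟩
        p^ᶻ c * (q * + p)   ∎)))
      where rearrange : ∀ q P C → q * (P * C) ≡ C * (q * P)
            rearrange = solve-∀

  ∥-maximal : ∀ {c k x} → p^ c ∥ x → p^ k ∣ x → k ≤ c
  ∥-maximal v d = ≮⇒≥ (λ c<k → ∥⇒∤ v c<k d)

  ∣∧∤⇒∥ : ∀ {c x} → p^ c ∣ x → ¬ p^ suc c ∣ x → p^ c ∥ x
  ∣∧∤⇒∥ {c} (p^∣ (divides q refl)) ∤ = p^∥ q (*-comm q (p^ᶻ c)) λ where
    (divides r refl) → ∤ (p^∣ (divides r (begin
      r * + p * p^ᶻ c    ≡⟨ *-assoc r (+ p) (p^ᶻ c) ⟩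
      r * (+ p * p^ᶻ c)  ≡⟨ cong (r *_) (p^ᶻ-suc c) ⟨
      r * p^ᶻ suc c      ∎)))

  ∤⇒∥ : ∀ {n x} → ¬ p^ n ∣ x → Σ ℕ λ c → c < n × p^ c ∥ x
  ∤⇒∥ {zero}  {x} ∤ = contradiction (p^0∣ x) ∤
  ∤⇒∥ {suc n} {x} ∤ with p^ n ∣? x
  ... | yes d = n , ≤-refl , ∣∧∤⇒∥ d ∤
  ... | no ¬d with ∤⇒∥ ¬d
  ...   | c , c<n , v = c , m≤n⇒m≤1+n c<n , v

  ∥-* : ∀ {c d x y} → p^ c ∥ x → p^ d ∥ y → p^ (c ℕ.+ d) ∥ x * y
  ∥-* {c} {d} (p^∥ v refl p∤v) (p^∥ w refl p∤w) = p^∥ (v * w) (begin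
    p^ᶻ c * v * (p^ᶻ d * w)     ≡⟨ interchange (p^ᶻ c) v (p^ᶻ d) w ⟩
    p^ᶻ c * p^ᶻ d * (v * w)     ≡⟨ cong (_* (v * w)) (p^ᶻ-+ c d) ⟨
    p^ᶻ (c ℕ.+ d) * (v * w)     ∎) (p∤-* p∤v p∤w)
    where interchange : ∀ A v B w → A * v * (B * w) ≡ A * B * (v * w)
          interchange = solve-∀

  ∥-^ : ∀ {c x} → p^ c ∥ x → ∀ k → p^ (k ℕ.* c) ∥ x ^ k
  ∥-^ v zero    = p^∥ (+ 1) refl p∤1
  ∥-^ v (suc k) = ∥-* v (∥-^ v k)

  ∥-+ : ∀ {c x y} → p^ c ∥ x → p^ suc c ∣ y → p^ c ∥ x + y
  ∥-+ v d = ∣∧∤⇒∥ (∣-+ (∥⇒∣ v) (∣-weaken (n≤1+n _) d)) (λ d′ → ∥⇒∤ v ≤-refl (∣-cancelʳ d′ d))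

  ∥-p^ᶻ : ∀ a → p^ a ∥ p^ᶻ a
  ∥-p^ᶻ a = p^∥ (+ 1) (sym (*-identityʳ (p^ᶻ a))) p∤1

  ∥-multiple : ∀ a {k} → 0 < k → k < p → p^ a ∥ + k * p^ᶻ a
  ∥-multiple a {suc k} _ k<p = p^∥ (+ suc k) (*-comm (+ suc k) (p^ᶻ a))
    (λ p∣k → <⇒≱ k<p (ℕ.∣⇒≤ (ℤ∣.∣⇒∣ᵤ p∣k)))

module ZeroPattern (p : ℕ) (p-prime : Prime p) (u : ℕ) (1≤u : 1 ℕ.≤ u) where

  open import Defs using (Poly; eval; numZerosMod; HasValuation)
  open import Data.Empty using (⊥)
  open import Data.List using ([])
  open import Function using (_∘_)
  open import Data.Integer using (ℤ; +_; -_; _+_; _*_; _-_; _^_; ∣_∣)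
  import Data.Integer.Divisibility as ℤᵤ
  import Data.Nat.Divisibility as ℕ∣
  open import Data.Integer.Divisibility.Signed as ℤ∣ using ()
  open import Data.Integer.Properties using (pos-+; pos-*; m-n≡m⊖n; ⊖-≥)
  open import Data.Integer.Tactic.RingSolver using (solve-∀)
  open import Data.Nat.Base using (zero; suc)
  open import Data.Nat.DivMod using (_/_; _%_; m≡m%n+[m/n]*n; m%n<n; m<n*o⇒m/o<n)
  import Data.Nat.Tactic.RingSolver as ℕRing
  open import Data.Nat.Properties as ℕ using (≤-refl; ≤-reflexive; <-≤-trans; n<1+n; m≤n⇒m<n∨m≡n)
  open import Data.Product using (Σ; _×_; _,_)
  open import Data.Sum using (_⊎_; inj₁; inj₂)
  open import Relation.Nullary using (¬_; Dec; yes; no; contradiction)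
  open import Relation.Nullary.Decidable using (_⊎-dec_)
  open import Relation.Binary.PropositionalEquality
  open Counting
  open Residues using (count-residue)
  open PolynomialArithmetic
  open Valuation p p-prime

  -- The roots are counted over every multiple of p^ℓ because a priori they are only
  -- periodic modulo p^(depth+u).
  record Pattern (ℓ m : ℕ) : Set where
    field
      poly           : Poly
      depth          : ℕ
      spine          : ℕ
      spine<p^ℓ      : spine ℕ.< p ℕ.^ ℓ
      dichotomy      : ∀ t → p^ (depth ℕ.+ u) ∣ eval poly t ⊎ ¬ p^ suc depth ∣ eval poly t
      exact-on-spine : ∀ t → p^ ℓ ∣ t - + spine → p^ depth ∥ eval poly t
      count-roots    : ∀ K → count (λ n → p^ (depth ℕ.+ u) ∣? eval poly (+ n)) (p ℕ.^ ℓ ℕ.* K) ≡ m ℕ.* K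

  trivial : Pattern 0 0
  trivial = record
    { poly           = 1ₚ
    ; depth          = 0
    ; spine          = 0
    ; spine<p^ℓ      = ℕ.s≤s ℕ.z≤n
    ; dichotomy      = λ t → inj₂ (∥⇒∤ (exact t) ≤-refl)
    ; exact-on-spine = λ t _ → exact t
    ; count-roots    = λ K → count-none _ (p ℕ.^ 0 ℕ.* K) (λ n _ → ∥⇒∤ (exact (+ n)) 1≤u)
    }
    where
    exact : ∀ t → p^ 0 ∥ eval 1ₚ t
    exact t = subst (p^ 0 ∥_) (sym (eval-1ₚ t)) (∥-p^ᶻ 0)

  module Extend (m : ℕ) {ℓ : ℕ} (C : Pattern ℓ (m / p)) where

    open Pattern C renaming (poly to P; depth to b; spine to s)

    q : ℕ
    q = m % p

    q<p : q ℕ.< p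
    q<p = m%n<n m p

    centre : ℕ → ℤ
    centre d = + s + + d * p^ᶻ ℓ

    centre<p^suc : ∀ {d} → d ℕ.< p → s ℕ.+ d ℕ.* p ℕ.^ ℓ ℕ.< p ℕ.^ suc ℓ
    centre<p^suc {d} d<p = <-≤-trans (ℕ.+-monoˡ-< (d ℕ.* p ℕ.^ ℓ) spine<p^ℓ) (ℕ.*-monoˡ-≤ (p ℕ.^ ℓ) d<p)

    +centre : ∀ d → + (s ℕ.+ d ℕ.* p ℕ.^ ℓ) ≡ centre d
    +centre d = trans (pos-+ s (d ℕ.* p ℕ.^ ℓ)) (cong (_+_ (+ s)) (pos-* d (p ℕ.^ ℓ)))

    spine⇒centre : ∀ t → p^ ℓ ∣ t - + s → ∀ d → p^ ℓ ∣ t - centre d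
    spine⇒centre t h d = subst (p^ ℓ ∣_) (identity t (+ s) (+ d) (p^ᶻ ℓ)) (∣-difference h (∣-multiple ℓ (+ d)))
      where identity : ∀ t s d A → t - s - d * A ≡ t - (s + d * A)
            identity = solve-∀

    centre⇒spine : ∀ t d → p^ suc ℓ ∣ t - centre d → p^ ℓ ∣ t - + s
    centre⇒spine t d h =
      subst (p^ ℓ ∣_) (identity t (+ s) (+ d) (p^ᶻ ℓ)) (∣-+ (∣-weaken (ℕ.n≤1+n ℓ) h) (∣-multiple ℓ (+ d)))
      where identity : ∀ t s d A → t - (s + d * A) + d * A ≡ t - s
            identity = solve-∀

    -- Centres s + j p^ℓ and s + d p^ℓ with j < d < p differ by a unit times p^ℓ.
    centres-apart : ∀ t {j d} → j ℕ.< d → d ℕ.< p → p^ suc ℓ ∣ t - centre j → ¬ p^ suc ℓ ∣ t - centre d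
    centres-apart t {j} {d} j<d d<p hj hd =
      ∥⇒∤ (∥-multiple ℓ (ℕ.m<n⇒0<n∸m j<d) (ℕ.≤-<-trans (ℕ.m∸n≤m d j) d<p)) ≤-refl
          (subst (p^ suc ℓ ∣_) difference (∣-difference hj hd))
      where
      identity : ∀ t s j d A → t - (s + j * A) - (t - (s + d * A)) ≡ (d - j) * A
      identity = solve-∀
      difference : t - centre j - (t - centre d) ≡ + (d ℕ.∸ j) * p^ᶻ ℓ
      difference = trans (identity t (+ s) (+ j) (+ d) (p^ᶻ ℓ))
                         (cong (_* p^ᶻ ℓ) (trans (m-n≡m⊖n d j) (⊖-≥ (ℕ.<⇒≤ j<d))))

    Near : ℕ → ℤ → Set
    Near zero    t = ⊥
    Near (suc d) t = Near d t ⊎ p^ suc ℓ ∣ t - centre d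

    near? : ∀ d t → Dec (Near d t)
    near? zero    t = no λ ()
    near? (suc d) t = near? d t ⊎-dec p^ suc ℓ ∣? t - centre d

    Near-intro : ∀ t {j d} → j ℕ.< d → p^ suc ℓ ∣ t - centre j → Near d t
    Near-intro t {j} {suc d} j<1+d h with m≤n⇒m<n∨m≡n (ℕ.≤-pred j<1+d)
    ... | inj₁ j<d  = inj₁ (Near-intro t j<d h)
    ... | inj₂ refl = inj₂ h

    Near⇒spine : ∀ t {d} → Near d t → p^ ℓ ∣ t - + s
    Near⇒spine t {suc d} (inj₁ near) = Near⇒spine t near
    Near⇒spine t {suc d} (inj₂ h)    = centre⇒spine t d h

    Near-apart : ∀ t {d e} → d ℕ.≤ e → e ℕ.< p → Near d t → ¬ p^ suc ℓ ∣ t - centre e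
    Near-apart t {suc d} d<e e<p (inj₁ near) = Near-apart t (ℕ.<⇒≤ d<e) e<p near
    Near-apart t {suc d} d<e e<p (inj₂ h)    = centres-apart t d<e e<p h

    Π : ℕ → Poly
    Π zero    = 1ₚ
    Π (suc d) = (X- centre d) ^ₚ u *ₚ Π d

    eval-Π : ∀ d t → eval (Π (suc d)) t ≡ (t - centre d) ^ u * eval (Π d) t
    eval-Π d t = begin
      eval ((X- centre d) ^ₚ u *ₚ Π d) t        ≡⟨ eval-*ₚ ((X- centre d) ^ₚ u) (Π d) t ⟩
      eval ((X- centre d) ^ₚ u) t * eval (Π d) t ≡⟨ cong (_* eval (Π d) t) (eval-^ₚ (X- centre d) u t) ⟩
      eval (X- centre d) t ^ u * eval (Π d) t    ≡⟨ cong (λ x → x ^ u * eval (Π d) t) (eval-X- (centre d) t) ⟩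
      (t - centre d) ^ u * eval (Π d) t          ∎
      where open ≡-Reasoning

    Π-∣ : ∀ {e t} d → (∀ j → p^ e ∣ t - centre j) → p^ (d ℕ.* (u ℕ.* e)) ∣ eval (Π d) t
    Π-∣ {t = t} zero    h = p^0∣ (eval 1ₚ t)
    Π-∣ {t = t} (suc d) h = subst (p^ _ ∣_) (sym (eval-Π d t)) (∣-* (∣-^ (h d) u) (Π-∣ d h))

    Π-∥ : ∀ {e t} d → (∀ j → j ℕ.< d → p^ e ∥ t - centre j) → p^ (d ℕ.* (u ℕ.* e)) ∥ eval (Π d) t
    Π-∥ {t = t} zero    h = subst (p^ 0 ∥_) (sym (eval-1ₚ t)) (∥-p^ᶻ 0)
    Π-∥ {t = t} (suc d) h = subst (p^ _ ∥_) (sym (eval-Π d t))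
      (∥-* (∥-^ (h d (n<1+n d)) u) (Π-∥ d (λ j j<d → h j (ℕ.m<n⇒m<1+n j<d))))

    Π-near : ∀ {t} d → (∀ j → p^ ℓ ∣ t - centre j) → Near d t → p^ (d ℕ.* (u ℕ.* ℓ) ℕ.+ u) ∣ eval (Π d) t
    Π-near {t} (suc d) h near = subst (p^ _ ∣_) (sym (eval-Π d t)) (∣-weaken (≤-reflexive exponent) (product near))
      where
      exponent : suc d ℕ.* (u ℕ.* ℓ) ℕ.+ u ≡ u ℕ.* ℓ ℕ.+ (d ℕ.* (u ℕ.* ℓ) ℕ.+ u)
      exponent = ℕ.+-assoc (u ℕ.* ℓ) (d ℕ.* (u ℕ.* ℓ)) u
      product : Near (suc d) t → p^ (u ℕ.* ℓ ℕ.+ (d ℕ.* (u ℕ.* ℓ) ℕ.+ u)) ∣ (t - centre d) ^ u * eval (Π d) t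
      product (inj₁ near) = ∣-* (∣-^ (h d) u) (Π-near d h near)
      product (inj₂ close) = ∣-weaken (≤-reflexive (identity u ℓ d)) (∣-* (∣-^ close u) (Π-∣ d h))
        where identity : ∀ u ℓ d → u ℕ.* ℓ ℕ.+ (d ℕ.* (u ℕ.* ℓ) ℕ.+ u) ≡ u ℕ.* (1 ℕ.+ ℓ) ℕ.+ d ℕ.* (u ℕ.* ℓ)
              identity = ℕRing.solve-∀

    M : ℕ
    M = q ℕ.* (u ℕ.* ℓ) ℕ.+ u

    P′ : Poly
    P′ = P ^ₚ M *ₚ Π q

    b′ : ℕ
    b′ = M ℕ.* b ℕ.+ q ℕ.* (u ℕ.* ℓ)

    eval-P′ : ∀ t → eval P′ t ≡ eval P t ^ M * eval (Π q) t
    eval-P′ t = trans (eval-*ₚ (P ^ₚ M) (Π q) t) (cong (_* eval (Π q) t) (eval-^ₚ P M t))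

    b′+u≤M[b+u] : b′ ℕ.+ u ℕ.≤ M ℕ.* (b ℕ.+ u) ℕ.+ 0
    b′+u≤M[b+u] = begin
      b′ ℕ.+ u                 ≡⟨ identity q u ℓ b ⟩
      M ℕ.* b ℕ.+ M ℕ.* 1      ≤⟨ ℕ.+-monoʳ-≤ (M ℕ.* b) (ℕ.*-monoʳ-≤ M 1≤u) ⟩
      M ℕ.* b ℕ.+ M ℕ.* u      ≡⟨ identity′ M b u ⟩
      M ℕ.* (b ℕ.+ u) ℕ.+ 0    ∎
      where
      open ℕ.≤-Reasoning
      identity : ∀ q u ℓ b → (q ℕ.* (u ℕ.* ℓ) ℕ.+ u) ℕ.* b ℕ.+ q ℕ.* (u ℕ.* ℓ) ℕ.+ u
                           ≡ (q ℕ.* (u ℕ.* ℓ) ℕ.+ u) ℕ.* b ℕ.+ (q ℕ.* (u ℕ.* ℓ) ℕ.+ u) ℕ.* 1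
      identity = ℕRing.solve-∀
      identity′ : ∀ M b u → M ℕ.* b ℕ.+ M ℕ.* u ≡ M ℕ.* (b ℕ.+ u) ℕ.+ 0
      identity′ = ℕRing.solve-∀

    Root′ : ℤ → Set
    Root′ t = p^ (b ℕ.+ u) ∣ eval P t ⊎ Near q t

    root′? : ∀ t → Dec (Root′ t)
    root′? t = p^ (b ℕ.+ u) ∣? eval P t ⊎-dec near? q t

    exact-off-centres : ∀ t → p^ ℓ ∣ t - + s → ¬ Near q t → p^ b′ ∥ eval P′ t
    exact-off-centres t h far = subst (p^ b′ ∥_) (sym (eval-P′ t))
      (∥-* (∥-^ (exact-on-spine t h) M) (Π-∥ q λ j j<q → ∣∧∤⇒∥ (spine⇒centre t h j) (far ∘ Near-intro t j<q)))

    root′⇒∣ : ∀ t → Root′ t → p^ (b′ ℕ.+ u) ∣ eval P′ t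
    root′⇒∣ t (inj₁ root) = subst (p^ _ ∣_) (sym (eval-P′ t))
      (∣-weaken b′+u≤M[b+u] (∣-* (∣-^ root M) (p^0∣ (eval (Π q) t))))
    root′⇒∣ t (inj₂ near) = subst (p^ _ ∣_) (sym (eval-P′ t))
      (∣-weaken (≤-reflexive (ℕ.+-assoc (M ℕ.* b) (q ℕ.* (u ℕ.* ℓ)) u))
        (∣-* (∣-^ (∥⇒∣ (exact-on-spine t on-spine)) M) (Π-near q (spine⇒centre t on-spine) near)))
      where on-spine = Near⇒spine t near

    bounded-off-spine : ∀ t → ¬ p^ ℓ ∣ t - + s → ¬ p^ suc b ∣ eval P t → ¬ p^ suc b′ ∣ eval P′ t
    bounded-off-spine t off-spine P∤ with ∤⇒∥ off-spine | ∤⇒∥ P∤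
    ... | e , e<ℓ , t-s∥ | c , c<1+b , P∥ =
      ∥⇒∤ (subst (p^ _ ∥_) (sym (eval-P′ t)) (∥-* (∥-^ P∥ M) (Π-∥ q λ j _ → off-centre j)))
          (ℕ.s≤s (ℕ.+-mono-≤ (ℕ.*-monoʳ-≤ M (ℕ.≤-pred c<1+b)) (ℕ.*-monoʳ-≤ q (ℕ.*-monoʳ-≤ u (ℕ.<⇒≤ e<ℓ)))))
      where
      off-centre : ∀ j → p^ e ∥ t - centre j
      off-centre j = subst (p^ e ∥_) (identity t (+ s) (+ j) (p^ᶻ ℓ))
        (∥-+ t-s∥ (∣-weaken e<ℓ (p^∣ (ℤ∣.∣m⇒∣-m (p^_∣_.proof (∣-multiple ℓ (+ j)))))))
        where identity : ∀ t s j A → t - s + - (j * A) ≡ t - (s + j * A)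
              identity = solve-∀

    nonroot′⇒∤ : ∀ t → ¬ Root′ t → ¬ p^ suc b′ ∣ eval P′ t
    nonroot′⇒∤ t nonroot with p^ ℓ ∣? t - + s | dichotomy t
    ... | yes on-spine | _         = ∥⇒∤ (exact-off-centres t on-spine (nonroot ∘ inj₂)) ≤-refl
    ... | no off-spine | inj₁ root = contradiction (inj₁ root) nonroot
    ... | no off-spine | inj₂ P∤   = bounded-off-spine t off-spine P∤

    count-Near : ∀ d → d ℕ.< p → ∀ K → count (near? d ∘ +_) (p ℕ.^ suc ℓ ℕ.* K) ≡ d ℕ.* K
    count-Near zero    _   K = count-none _ (p ℕ.^ suc ℓ ℕ.* K) (λ _ _ ())
    count-Near (suc d) 1+d<p K = begin
      count (near? (suc d) ∘ +_) N                                               ≡⟨ count-⊎ _ _ apart N ⟩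
      count (near? d ∘ +_) N ℕ.+ count (λ n → p^ suc ℓ ∣? + n - centre d) N    ≡⟨ cong₂ ℕ._+_ (count-Near d d<p K) class ⟩
      d ℕ.* K ℕ.+ K                                                              ≡⟨ ℕ.+-comm (d ℕ.* K) K ⟩
      suc d ℕ.* K                                                                ∎
      where
      open ≡-Reasoning
      N = p ℕ.^ suc ℓ ℕ.* K
      d<p : d ℕ.< p
      d<p = ℕ.<⇒≤ 1+d<p
      apart : ∀ n → Near d (+ n) → ¬ p^ suc ℓ ∣ + n - centre d
      apart n = Near-apart (+ n) ≤-refl d<p
      class : count (λ n → p^ suc ℓ ∣? + n - centre d) N ≡ K
      class = trans (count-cong _ _ (λ n → p^_∣_.proof ∘ subst (λ c → p^ suc ℓ ∣ + n - c) (sym (+centre d)))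
                                    (λ n → subst (λ c → p^ suc ℓ ∣ + n - c) (+centre d) ∘ p^∣) N)
                    (count-residue (centre<p^suc d<p) K)

    count-roots′ : ∀ K → count (λ n → p^ (b′ ℕ.+ u) ∣? eval P′ (+ n)) (p ℕ.^ suc ℓ ℕ.* K) ≡ m ℕ.* K
    count-roots′ K = begin
      count (λ n → p^ (b′ ℕ.+ u) ∣? eval P′ (+ n)) N
        ≡⟨ count-cong _ _ (λ n → ∣⇒root′ (+ n)) (λ n → root′⇒∣ (+ n)) N ⟩
      count (root′? ∘ +_) N
        ≡⟨ count-⊎ _ _ (λ n root near → ∥⇒∤ (exact-on-spine (+ n) (Near⇒spine (+ n) near)) (ℕ.m<m+n b 1≤u) root) N ⟩
      count (λ n → p^ (b ℕ.+ u) ∣? eval P (+ n)) N ℕ.+ count (near? q ∘ +_) N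
        ≡⟨ cong₂ ℕ._+_ (trans (cong (count _) (regroup p (p ℕ.^ ℓ) K)) (count-roots (p ℕ.* K))) (count-Near q q<p K) ⟩
      m / p ℕ.* (p ℕ.* K) ℕ.+ q ℕ.* K
        ≡⟨ regroup′ (m / p) p q K ⟩
      (q ℕ.+ m / p ℕ.* p) ℕ.* K
        ≡⟨ cong (ℕ._* K) (m≡m%n+[m/n]*n m p) ⟨
      m ℕ.* K ∎
      where
      open ≡-Reasoning
      N = p ℕ.^ suc ℓ ℕ.* K
      ∣⇒root′ : ∀ t → p^ (b′ ℕ.+ u) ∣ eval P′ t → Root′ t
      ∣⇒root′ t d with root′? t
      ... | yes root = root
      ... | no ¬root = contradiction (∣-weaken (ℕ.m<m+n b′ 1≤u) d) (nonroot′⇒∤ t ¬root)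
      regroup : ∀ p A K → p ℕ.* A ℕ.* K ≡ A ℕ.* (p ℕ.* K)
      regroup = ℕRing.solve-∀
      regroup′ : ∀ x p q K → x ℕ.* (p ℕ.* K) ℕ.+ q ℕ.* K ≡ (q ℕ.+ x ℕ.* p) ℕ.* K
      regroup′ = ℕRing.solve-∀

    extend : Pattern (suc ℓ) m
    extend = record
      { poly           = P′
      ; depth          = b′
      ; spine          = s ℕ.+ q ℕ.* p ℕ.^ ℓ
      ; spine<p^ℓ      = centre<p^suc q<p
      ; dichotomy      = dichotomy′
      ; exact-on-spine = λ t h → let h′ = subst (λ c → p^ suc ℓ ∣ t - c) (+centre q) h in
                                 exact-off-centres t (centre⇒spine t q h′) (λ near → Near-apart t ≤-refl q<p near h′)
      ; count-roots    = count-roots′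
      }
      where
      dichotomy′ : ∀ t → p^ (b′ ℕ.+ u) ∣ eval P′ t ⊎ ¬ p^ suc b′ ∣ eval P′ t
      dichotomy′ t with root′? t
      ... | yes root = inj₁ (root′⇒∣ t root)
      ... | no ¬root = inj₂ (nonroot′⇒∤ t ¬root)

  construct : ∀ ℓ m → m ℕ.< p ℕ.^ ℓ → Pattern ℓ m
  construct zero    zero    _           = trivial
  construct zero    (suc m) (ℕ.s≤s ())
  construct (suc ℓ) m       m<p^[1+ℓ]   =
    Extend.extend m (construct ℓ (m / p) (m<n*o⇒m/o<n (subst (m ℕ.<_) (ℕ.*-comm p (p ℕ.^ ℓ)) m<p^[1+ℓ])))

  Realises : (ℓ m r : ℕ) → Poly → Set
  Realises ℓ m r P =
    (numZerosMod P (p ℕ.^ (r ℕ.+ ℓ)) ≡ m ℕ.* p ℕ.^ r) ×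
    ((t : ℤ) → ¬ (+ (p ℕ.^ (r ℕ.+ ℓ)) ℤᵤ.∣ eval P t) → (k : ℕ) → HasValuation p (eval P t) k → k ℕ.+ u ℕ.≤ r ℕ.+ ℓ)

  -- Multiplying by p^X shifts every valuation by X, and X is chosen to move the root
  -- threshold depth + u to r + ℓ.
  realise : ∀ {ℓ m} → Pattern ℓ m → ∀ R → Σ ℕ λ r → r ℕ.≥ R × Σ Poly (Realises ℓ m r)
  realise {ℓ} {m} C R = r , ℕ.m≤n+m R (depth ℕ.+ u) , p^ᶻ X ·ₚ poly , zeros , valuation-bound
    where
    open Pattern C
    X = R ℕ.+ ℓ
    r = depth ℕ.+ u ℕ.+ R
    r+ℓ≡X+[b+u] : r ℕ.+ ℓ ≡ X ℕ.+ (depth ℕ.+ u)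
    r+ℓ≡X+[b+u] = identity depth u R ℓ
      where identity : ∀ b u R ℓ → b ℕ.+ u ℕ.+ R ℕ.+ ℓ ≡ R ℕ.+ ℓ ℕ.+ (b ℕ.+ u)
            identity = ℕRing.solve-∀
    root⇒∣ : ∀ t → p^ (depth ℕ.+ u) ∣ eval poly t → p^ (r ℕ.+ ℓ) ∣ eval (p^ᶻ X ·ₚ poly) t
    root⇒∣ t root = subst₂ p^_∣_ (sym r+ℓ≡X+[b+u]) (sym (eval-·ₚ (p^ᶻ X) poly t)) (∣-* (∥⇒∣ (∥-p^ᶻ X)) root)
    ∣⇒root : ∀ t → p^ (r ℕ.+ ℓ) ∣ eval (p^ᶻ X ·ₚ poly) t → p^ (depth ℕ.+ u) ∣ eval poly t
    ∣⇒root t d = p^-cancelˡ-∣ X (subst₂ p^_∣_ r+ℓ≡X+[b+u] (eval-·ₚ (p^ᶻ X) poly t) d)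
    zeros : numZerosMod (p^ᶻ X ·ₚ poly) (p ℕ.^ (r ℕ.+ ℓ)) ≡ m ℕ.* p ℕ.^ r
    zeros = begin
      numZerosMod (p^ᶻ X ·ₚ poly) (p ℕ.^ (r ℕ.+ ℓ))
        ≡⟨ length-filter-upTo _ (p ℕ.^ (r ℕ.+ ℓ)) ⟩
      count (λ n → p ℕ.^ (r ℕ.+ ℓ) ℕ∣.∣? ∣ eval (p^ᶻ X ·ₚ poly) (+ n) ∣) (p ℕ.^ (r ℕ.+ ℓ))
        ≡⟨ count-cong _ _ (λ n d → ∣⇒root (+ n) (p^∣ (ℤ∣.∣ᵤ⇒∣ d))) (λ n root → ℤ∣.∣⇒∣ᵤ (p^_∣_.proof (root⇒∣ (+ n) root))) (p ℕ.^ (r ℕ.+ ℓ)) ⟩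
      count (λ n → p^ (depth ℕ.+ u) ∣? eval poly (+ n)) (p ℕ.^ (r ℕ.+ ℓ))
        ≡⟨ cong (count _) (trans (ℕ.^-distribˡ-+-* p r ℓ) (ℕ.*-comm (p ℕ.^ r) (p ℕ.^ ℓ))) ⟩
      count (λ n → p^ (depth ℕ.+ u) ∣? eval poly (+ n)) (p ℕ.^ ℓ ℕ.* p ℕ.^ r)
        ≡⟨ count-roots (p ℕ.^ r) ⟩
      m ℕ.* p ℕ.^ r ∎
      where open ≡-Reasoning
    valuation-bound : (t : ℤ) → ¬ (+ (p ℕ.^ (r ℕ.+ ℓ)) ℤᵤ.∣ eval (p^ᶻ X ·ₚ poly) t) →
                      (k : ℕ) → HasValuation p (eval (p^ᶻ X ·ₚ poly) t) k → k ℕ.+ u ℕ.≤ r ℕ.+ ℓ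
    valuation-bound t ¬N∣ k (p^k∣ , _) with dichotomy t
    ... | inj₁ root = contradiction (ℤ∣.∣⇒∣ᵤ (p^_∣_.proof (root⇒∣ t root))) ¬N∣
    ... | inj₂ ∤ with ∤⇒∥ ∤
    ...   | c , c<1+b , poly∥ = begin
      k ℕ.+ u                   ≤⟨ ℕ.+-monoˡ-≤ u (∥-maximal Pf∥ (p^∣ (ℤ∣.∣ᵤ⇒∣ p^k∣))) ⟩
      X ℕ.+ c ℕ.+ u             ≤⟨ ℕ.+-monoˡ-≤ u (ℕ.+-monoʳ-≤ X (ℕ.≤-pred c<1+b)) ⟩
      X ℕ.+ depth ℕ.+ u         ≡⟨ ℕ.+-assoc X depth u ⟩
      X ℕ.+ (depth ℕ.+ u)       ≡⟨ r+ℓ≡X+[b+u] ⟨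
      r ℕ.+ ℓ                   ∎
      where
      open ℕ.≤-Reasoning
      Pf∥ : p^ (X ℕ.+ c) ∥ eval (p^ᶻ X ·ₚ poly) t
      Pf∥ = subst (p^ _ ∥_) (sym (eval-·ₚ (p^ᶻ X) poly t)) (∥-* (∥-p^ᶻ X) poly∥)

  realise-all : ∀ ℓ R → Σ ℕ λ r → r ℕ.≥ R × Σ Poly (Realises ℓ (p ℕ.^ ℓ) r)
  realise-all ℓ R = R , ≤-refl , [] , zeros , λ t N∤0 → contradiction (ℕ∣._∣0 (p ℕ.^ (R ℕ.+ ℓ))) N∤0
    where
    zeros : numZerosMod [] (p ℕ.^ (R ℕ.+ ℓ)) ≡ p ℕ.^ ℓ ℕ.* p ℕ.^ R
    zeros = trans (length-filter-upTo _ (p ℕ.^ (R ℕ.+ ℓ)))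
           (trans (count-all _ (λ _ → ℕ∣._∣0 (p ℕ.^ (R ℕ.+ ℓ))) (p ℕ.^ (R ℕ.+ ℓ)))
           (trans (ℕ.^-distribˡ-+-* p R ℓ) (ℕ.*-comm (p ℕ.^ R) (p ℕ.^ ℓ))))

  realise-any : ∀ ℓ m → m ℕ.≤ p ℕ.^ ℓ → ∀ R → Σ ℕ λ r → r ℕ.≥ R × Σ Poly (Realises ℓ m r)
  realise-any ℓ m m≤p^ℓ R with m≤n⇒m<n∨m≡n m≤p^ℓ
  ... | inj₁ m<p^ℓ = realise (construct ℓ m m<p^ℓ) R
  ... | inj₂ refl  = realise-all ℓ R


open import Defs
open import Data.Nat using (ℕ; _+_; _*_; _^_; _≤_; _≥_)
open import Data.Nat.Primality using (Prime)
open import Data.Integer using (ℤ; +_)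
open import Data.Integer.Divisibility using (_∣_)
open import Data.Product using (Σ; _×_)
open import Relation.Nullary using (¬_)
open import Relation.Binary.PropositionalEquality using (_≡_)

lemma37 : (p ℓ u m : ℕ) → Prime p → ℓ ≥ 1 → u ≥ 1 → m ≤ p ^ ℓ →
    (R : ℕ) → Σ ℕ λ r → r ≥ R × Σ Poly λ P →
      (numZerosMod P (p ^ (r + ℓ)) ≡ m * p ^ r) ×
      ((t : ℤ) → ¬ (+ (p ^ (r + ℓ)) ∣ eval P t) →
        (k : ℕ) → HasValuation p (eval P t) k → k + u ≤ r + ℓ)
lemma37 p ℓ u m p-prime _ 1≤u = ZeroPattern.realise-any p p-prime u 1≤u ℓ m
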